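{- For $n\ge1$ let $A_n$ be the set of $n\times 2$ arrays $m=(m_{i,j})_{1\le i\le n,\,1\le j\le 2}$ with entries in $\{0,1,2\}$ such that for all $i,j$: (i) if $m_{i,j}=1$ then either ($i\ge 2$ and $m_{i-1,j}=0$) or ($j=2$ and $m_{i,1}=0$), i.e. every $1$ has a $0$ immediately above it or immediately to its left; (ii) if $m_{i,j}=0$ then ($i=1$ or $m_{i-1,j}\ne 0$) and ($j=1$ or $m_{i,1}\neq0$), i.e. no $0$ has a $0$ immediately above it or immediately to its left; (iii) if $m_{i,j}=2$ then $i\ge 3$, $m_{i-1,j}=1$ and $m_{i-2,j}=0$, i.e. every $2$ has $1$ immediately above it and $0$ directly above that. Let $d_n=|A_n|$. Then $$d_n=d_{n-1}+2d_{n-3}\quad\text{for } n\ge 4,\qquad d_1=1,\ d_2=1,\ d_3=2.$$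
   Context: For example $A_1=\{(0\ 1)\}$ and $A_2=\left\{\begin{pmatrix}0&1\\1&0\end{pmatrix}\right\}$. -}

module Defs where

open import Data.Nat using (ℕ; zero; suc)
open import Data.Fin using (Fin; toℕ) renaming (zero to fz; suc to fs)
open import Data.Vec using (Vec; lookup)
open import Data.List using (List; length)
open import Data.List.Relation.Unary.Unique.Propositional using (Unique)
open import Data.List.Membership.Propositional using (_∈_)
open import Data.Product using (Σ; ∃; _×_)
open import Data.Sum using (_⊎_)
open import Function.Bundles using (_⇔_)
open import Relation.Binary.PropositionalEquality using (_≡_; _≢_)

-- An n×2 array with entries in {0,1,2}: a vector of n rows, each row a
-- vector of 2 entries in Fin 3.  Row/column indices are 0-based Fin's:
-- 0-based row r corresponds to paper row i = r+1, column c to j = c+1.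
Array : ℕ → Set
Array n = Vec (Vec (Fin 3) 2) n

val : ∀ {n} → Array n → Fin n → Fin 2 → ℕ
val m i j = toℕ (lookup (lookup m i) j)

AboveIs : ∀ {n} → Array n → Fin n → Fin 2 → ℕ → Set
AboveIs {n} m i j k = Σ (Fin n) λ i' → toℕ i ≡ suc (toℕ i') × val m i' j ≡ k

AboveNonzero : ∀ {n} → Array n → Fin n → Fin 2 → Set
AboveNonzero {n} m i j = Σ (Fin n) λ i' → toℕ i ≡ suc (toℕ i') × val m i' j ≢ 0

TwoAbove : ∀ {n} → Array n → Fin n → Fin 2 → Set
TwoAbove {n} m i j = Σ (Fin n) λ i₁ → Σ (Fin n) λ i₂ →
  toℕ i ≡ suc (toℕ i₁) × toℕ i₁ ≡ suc (toℕ i₂) × val m i₁ j ≡ 1 × val m i₂ j ≡ 0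

InA : ∀ {n} → Array n → Set
InA {n} m = (i : Fin n) (j : Fin 2) →
    (val m i j ≡ 1 → AboveIs m i j 0 ⊎ (toℕ j ≡ 1 × val m i fz ≡ 0))
  × (val m i j ≡ 0 → (toℕ i ≡ 0 ⊎ AboveNonzero m i j) × (toℕ j ≡ 0 ⊎ val m i fz ≢ 0))
  × (val m i j ≡ 2 → TwoAbove m i j)

HasCard : ℕ → ℕ → Set
HasCard n k = Σ (List (Array n)) λ xs →
  Unique xs × (∀ m → (m ∈ xs) ⇔ InA m) × length xs ≡ k

-- Conditions (i)–(iii) constrain a row only through the two rows above it, so the
-- arrays of A_n are the length-n walks of a finite automaton whose states are pairs
-- of consecutive rows, and d_n is the number of such walks from the empty state.
-- The first two rows are forced to be (0 1), (1 0), after which only ten pairs are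
-- reachable; their counts satisfy a small linear system from which
-- d_n = d_{n-1} + 2 d_{n-3} follows.

module Submission where

open import Defs
open import Data.Nat using (ℕ; zero; suc; _≤_; _+_; _*_; _∸_; _≟_; s≤s)
open import Data.Nat.ListAction using (sum)
open import Data.Nat.Properties using (suc-injective; +-identityʳ)
open import Data.Fin using (Fin; toℕ; inject₁) renaming (zero to fz; suc to fs)
open import Data.Fin.Properties using (toℕ-inject₁; toℕ-injective; all?)
open import Data.Vec using (Vec; []; _∷_; lookup)
open import Data.Vec.Properties using (∷-injectiveʳ)
open import Data.Maybe using (Maybe; just; nothing)
open import Data.List
  using (List; [_]; map; concatMap; filter; length; allFin; cartesianProductWith)
  renaming ([] to []ₗ; _∷_ to _∷ₗ_)
open import Data.List.Properties using (length-++; length-map; map-cong)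
open import Data.List.Relation.Unary.Any using (here)
import Data.List.Relation.Unary.All as All
import Data.List.Relation.Unary.All.Properties as All
import Data.List.Relation.Unary.AllPairs as AllPairs
import Data.List.Relation.Unary.AllPairs.Properties as AllPairs
open import Data.List.Relation.Unary.Unique.Propositional using (Unique)
import Data.List.Relation.Unary.Unique.Propositional.Properties as Unique
open import Data.List.Relation.Binary.Disjoint.Propositional using (Disjoint)
open import Data.List.Membership.Propositional using (_∈_; find; lose)
open import Data.List.Membership.Propositional.Properties
  using (∈-map⁺; ∈-map⁻; ∈-filter⁺; ∈-filter⁻; ∈-concatMap⁺; ∈-concatMap⁻;
         ∈-allFin; ∈-cartesianProductWith⁺)
open import Data.Product using (Σ; _×_; _,_; proj₂)
open import Data.Product.Function.NonDependent.Propositional using (_×-⇔_)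
open import Data.Sum using (_⊎_)
open import Data.Sum.Function.Propositional using (_⊎-⇔_)
open import Data.Empty using (⊥)
open import Data.Unit using (⊤; tt)
open import Function using (id; _∘_)
open import Function.Bundles using (_⇔_; mk⇔; Equivalence)
open import Function.Construct.Identity using (⇔-id)
open import Function.Construct.Symmetry using (⇔-sym)
open import Function.Construct.Composition using (_⇔-∘_)
open import Function.Related.TypeIsomorphisms using (→-cong-⇔)
open import Relation.Nullary using (Dec; yes; no; ¬?)
open import Relation.Nullary.Decidable using (_×-dec_; _⊎-dec_; _→-dec_)
open import Relation.Unary using (Decidable)
open import Relation.Binary.PropositionalEquality
  using (_≡_; _≢_; refl; sym; trans; cong; cong₂; subst)
open Relation.Binary.PropositionalEquality.≡-Reasoning

open Equivalence using (to; from)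

length-concatMap : ∀ {A B : Set} (f : A → List B) xs →
  length (concatMap f xs) ≡ sum (map (length ∘ f) xs)
length-concatMap f []ₗ       = refl
length-concatMap f (x ∷ₗ xs) =
  trans (length-++ (f x)) (cong (length (f x) +_) (length-concatMap f xs))

module SecondOrderChains
  {A : Set} (R : Maybe A → Maybe A → A → Set) (R? : ∀ u v → Decidable (R u v))
  (elems : List A) (∈-elems : ∀ x → x ∈ elems) (elems-unique : Unique elems)
  where

  -- u and v are the two entries preceding w; nothing marks a position before the start.
  Chain : Maybe A → Maybe A → ∀ {k} → Vec A k → Set
  Chain u v []      = ⊤
  Chain u v (z ∷ w) = R u v z × Chain v (just z) w

  chains : Maybe A → Maybe A → (k : ℕ) → List (Vec A k)
  chains u v zero    = [ [] ]
  chains u v (suc k) = concatMap (λ z → map (z ∷_) (chains v (just z) k)) (filter (R? u v) elems)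

  #chains : Maybe A → Maybe A → ℕ → ℕ
  #chains u v zero    = 1
  #chains u v (suc k) = sum (map (λ z → #chains v (just z) k) (filter (R? u v) elems))

  ∈-chains : ∀ {k} u v (w : Vec A k) → w ∈ chains u v k ⇔ Chain u v w
  ∈-chains u v []      = mk⇔ (λ _ → tt) (λ _ → here refl)
  ∈-chains u v (z ∷ w) = mk⇔ into onto
    where
    into : z ∷ w ∈ chains u v (suc _) → Chain u v (z ∷ w)
    into m with find (∈-concatMap⁻ _ {xs = filter (R? u v) elems} m)
    ... | z′ , z′∈ , m′ with ∈-map⁻ (z′ ∷_) m′
    ... | w′ , w′∈ , refl = proj₂ (∈-filter⁻ (R? u v) {xs = elems} z′∈) , to (∈-chains v (just z) w) w′∈
    onto : Chain u v (z ∷ w) → z ∷ w ∈ chains u v (suc _)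
    onto (r , c) = ∈-concatMap⁺ _
      (lose (∈-filter⁺ (R? u v) (∈-elems z) r) (∈-map⁺ (z ∷_) (from (∈-chains v (just z) w) c)))

  private
    ∷-disjoint : ∀ {k} {z z′ : A} {ws ws′ : List (Vec A k)} →
      z ≢ z′ → Disjoint (map (z ∷_) ws) (map (z′ ∷_) ws′)
    ∷-disjoint z≢z′ (m , m′) with ∈-map⁻ (_ ∷_) m | ∈-map⁻ (_ ∷_) m′
    ... | _ , _ , refl | _ , _ , refl = z≢z′ refl

  chains-unique : ∀ u v k → Unique (chains u v k)
  chains-unique u v zero    = All.[] AllPairs.∷ AllPairs.[]
  chains-unique u v (suc k) = Unique.concat⁺
    (All.map⁺ (All.universal (λ z → Unique.map⁺ ∷-injectiveʳ (chains-unique v (just z) k)) _))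
    (AllPairs.map⁺ (AllPairs.map ∷-disjoint (Unique.filter⁺ (R? u v) elems-unique)))

  length-chains : ∀ u v k → length (chains u v k) ≡ #chains u v k
  length-chains u v zero    = refl
  length-chains u v (suc k) = begin
    length (concatMap (λ z → map (z ∷_) (chains v (just z) k)) zs)
      ≡⟨ length-concatMap _ zs ⟩
    sum (map (λ z → length (map (z ∷_) (chains v (just z) k))) zs)
      ≡⟨ cong sum (map-cong length-extensions zs) ⟩
    sum (map (λ z → #chains v (just z) k) zs) ∎
    where
    zs : List A
    zs = filter (R? u v) elems
    length-extensions : ∀ z → length (map (z ∷_) (chains v (just z) k)) ≡ #chains v (just z) k
    length-extensions z = trans (length-map (z ∷_) (chains v (just z) k)) (length-chains v (just z) k)

Row : Set
Row = Vec (Fin 3) 2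

entry : Row → Fin 2 → ℕ
entry r j = toℕ (lookup r j)

CellConditions : (a a₁ : ℕ) (j : Fin 2) (zeroAbove atTop nonzeroAbove oneZeroAbove : Set) → Set
CellConditions a a₁ j zeroAbove atTop nonzeroAbove oneZeroAbove =
    (a ≡ 1 → zeroAbove ⊎ (toℕ j ≡ 1 × a₁ ≡ 0))
  × (a ≡ 0 → (atTop ⊎ nonzeroAbove) × (toℕ j ≡ 0 ⊎ a₁ ≢ 0))
  × (a ≡ 2 → oneZeroAbove)

cellConditions-cong : ∀ {a a₁ j Z Z′ T T′ N N′ O O′} →
  Z ⇔ Z′ → T ⇔ T′ → N ⇔ N′ → O ⇔ O′ →
  CellConditions a a₁ j Z T N O ⇔ CellConditions a a₁ j Z′ T′ N′ O′
cellConditions-cong Z T N O =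
       →-cong-⇔ (⇔-id _) (Z ⊎-⇔ (⇔-id _))
  ×-⇔ →-cong-⇔ (⇔-id _) ((T ⊎-⇔ N) ×-⇔ (⇔-id _))
  ×-⇔ →-cong-⇔ (⇔-id _) O

cellConditions? : ∀ a a₁ j {Z T N O} → Dec Z → Dec T → Dec N → Dec O →
  Dec (CellConditions a a₁ j Z T N O)
cellConditions? a a₁ j Z? T? N? O? =
        (a ≟ 1 →-dec (Z? ⊎-dec (toℕ j ≟ 1 ×-dec a₁ ≟ 0)))
  ×-dec (a ≟ 0 →-dec ((T? ⊎-dec N?) ×-dec (toℕ j ≟ 0 ⊎-dec ¬? (a₁ ≟ 0))))
  ×-dec (a ≟ 2 →-dec O?)

-- nothing stands for a row above the top of the array.
EntryAbove : Maybe Row → Fin 2 → (ℕ → Set) → Set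
EntryAbove nothing  j P = ⊥
EntryAbove (just r) j P = P (entry r j)

entryAbove? : ∀ {P : ℕ → Set} → Decidable P → ∀ v j → Dec (EntryAbove v j P)
entryAbove? P? nothing  j = no λ ()
entryAbove? P? (just r) j = P? (entry r j)

isNothing? : (v : Maybe Row) → Dec (v ≡ nothing)
isNothing? nothing  = yes refl
isNothing? (just _) = no λ ()

AdmissibleCell : Maybe Row → Maybe Row → Row → Fin 2 → Set
AdmissibleCell u v z j = CellConditions (entry z j) (entry z fz) j
  (EntryAbove v j (_≡ 0)) (v ≡ nothing) (EntryAbove v j (_≢ 0))
  (EntryAbove v j (_≡ 1) × EntryAbove u j (_≡ 0))

Admissible : Maybe Row → Maybe Row → Row → Set
Admissible u v z = ∀ j → AdmissibleCell u v z j

admissible? : ∀ u v → Decidable (Admissible u v)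
admissible? u v z = all? λ j → cellConditions? _ _ j
  (entryAbove? (_≟ 0) v j) (isNothing? v) (entryAbove? (¬? ∘ (_≟ 0)) v j)
  (entryAbove? (_≟ 1) v j ×-dec entryAbove? (_≟ 0) u j)

row : Fin 3 → Fin 3 → Row
row a b = a ∷ b ∷ []

rows : List Row
rows = cartesianProductWith row (allFin 3) (allFin 3)

∈-rows : ∀ r → r ∈ rows
∈-rows (a ∷ b ∷ []) = ∈-cartesianProductWith⁺ row (∈-allFin a) (∈-allFin b)

rows-unique : Unique rows
rows-unique = Unique.cartesianProductWith⁺ row (λ { refl → refl , refl })
  (Unique.allFin⁺ 3) (Unique.allFin⁺ 3)

open SecondOrderChains Admissible admissible? rows ∈-rows rows-unique

above : ∀ {n} → Maybe Row → Array n → Fin n → Maybe Row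
above v m fz     = v
above v m (fs i) = just (lookup m (inject₁ i))

twoAbove : ∀ {n} → Maybe Row → Maybe Row → Array n → Fin n → Maybe Row
twoAbove u v m fz     = u
twoAbove u v m (fs i) = above v m (inject₁ i)

above-∷ : ∀ {n} v z (w : Array n) i → above v (z ∷ w) (fs i) ≡ above (just z) w i
above-∷ v z w fz     = refl
above-∷ v z w (fs i) = refl

twoAbove-∷ : ∀ {n} u v z (w : Array n) i → twoAbove u v (z ∷ w) (fs i) ≡ twoAbove v (just z) w i
twoAbove-∷ u v z w fz     = refl
twoAbove-∷ u v z w (fs i) = above-∷ v z w (inject₁ i)

AdmissibleAt : ∀ {n} → Maybe Row → Maybe Row → Array n → Fin n → Set
AdmissibleAt u v m i = Admissible (twoAbove u v m i) (above v m i) (lookup m i)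

admissibleAt-∷ : ∀ {n} u v z (w : Array n) i →
  AdmissibleAt u v (z ∷ w) (fs i) ≡ AdmissibleAt v (just z) w i
admissibleAt-∷ u v z w i =
  cong₂ (λ s t → Admissible s t (lookup w i)) (twoAbove-∷ u v z w i) (above-∷ v z w i)

chain⇔admissibleAt : ∀ {n} u v (m : Array n) → Chain u v m ⇔ (∀ i → AdmissibleAt u v m i)
chain⇔admissibleAt u v []      = mk⇔ (λ _ ()) (λ _ → tt)
chain⇔admissibleAt u v (z ∷ w) = mk⇔ into onto
  where
  rest : Chain v (just z) w ⇔ (∀ i → AdmissibleAt v (just z) w i)
  rest = chain⇔admissibleAt v (just z) w
  into : Chain u v (z ∷ w) → ∀ i → AdmissibleAt u v (z ∷ w) i
  into (r , c) fz     = r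
  into (r , c) (fs i) = subst id (sym (admissibleAt-∷ u v z w i)) (to rest c i)
  onto : (∀ i → AdmissibleAt u v (z ∷ w) i) → Chain u v (z ∷ w)
  onto a = a fz , from rest (λ i → subst id (admissibleAt-∷ u v z w i) (a (fs i)))

Predecessor : ∀ {n} → (Fin n → Set) → Fin n → Set
Predecessor {n} P i = Σ (Fin n) λ i′ → toℕ i ≡ suc (toℕ i′) × P i′

predecessor-fs : ∀ {n} {P : Fin (suc n) → Set} (i : Fin n) →
  Predecessor P (fs i) ⇔ P (inject₁ i)
predecessor-fs {P = P} i = mk⇔
  (λ { (i′ , e , p) → subst P (toℕ-injective (sym (trans (toℕ-inject₁ i) (suc-injective e)))) p })
  (λ p → inject₁ i , cong suc (sym (toℕ-inject₁ i)) , p)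

predecessor⇔entryAbove : ∀ {n} (m : Array n) i j (P : ℕ → Set) →
  Predecessor (λ i′ → P (val m i′ j)) i ⇔ EntryAbove (above nothing m i) j P
predecessor⇔entryAbove m fz     j P = mk⇔ (λ { (_ , () , _) }) λ ()
predecessor⇔entryAbove m (fs i) j P = predecessor-fs i

atTop⇔ : ∀ {n} (m : Array n) i → toℕ i ≡ 0 ⇔ above nothing m i ≡ nothing
atTop⇔ m fz     = mk⇔ (λ _ → refl) (λ _ → refl)
atTop⇔ m (fs i) = mk⇔ (λ ()) (λ ())

twoAbove⇔ : ∀ {n} (m : Array n) i j →
  TwoAbove m i j ⇔
    (EntryAbove (above nothing m i) j (_≡ 1) × EntryAbove (twoAbove nothing nothing m i) j (_≡ 0))
twoAbove⇔ m fz     j = mk⇔ (λ { (_ , _ , () , _) }) (λ { (() , _) })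
twoAbove⇔ m (fs i) j =
      (⇔-id _ ×-⇔ predecessor⇔entryAbove m (inject₁ i) j (_≡ 0))
  ⇔-∘ (predecessor-fs i ⇔-∘ regroup)
  where
  regroup : TwoAbove m (fs i) j ⇔ Predecessor (λ i₁ → val m i₁ j ≡ 1 × AboveIs m i₁ j 0) (fs i)
  regroup = mk⇔ (λ { (i₁ , i₂ , e₁ , e₂ , p , q) → i₁ , e₁ , p , i₂ , e₂ , q })
                (λ { (i₁ , e₁ , p , i₂ , e₂ , q) → i₁ , i₂ , e₁ , e₂ , p , q })

cell⇔admissibleCell : ∀ {n} (m : Array n) i j →
  CellConditions (val m i j) (val m i fz) j
    (AboveIs m i j 0) (toℕ i ≡ 0) (AboveNonzero m i j) (TwoAbove m i j)
  ⇔ AdmissibleCell (twoAbove nothing nothing m i) (above nothing m i) (lookup m i) j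
cell⇔admissibleCell m i j = cellConditions-cong
  (predecessor⇔entryAbove m i j (_≡ 0)) (atTop⇔ m i)
  (predecessor⇔entryAbove m i j (_≢ 0)) (twoAbove⇔ m i j)

InA⇔admissibleAt : ∀ {n} (m : Array n) → InA m ⇔ (∀ i → AdmissibleAt nothing nothing m i)
InA⇔admissibleAt m = mk⇔
  (λ a i j → to (cell⇔admissibleCell m i j) (a i j))
  (λ a i j → from (cell⇔admissibleCell m i j) (a i j))

A-hasCard : ∀ n → HasCard n (#chains nothing nothing n)
A-hasCard n = chains nothing nothing n
            , chains-unique nothing nothing n
            , (λ m → ⇔-sym (InA⇔admissibleAt m)
                 ⇔-∘ (chain⇔admissibleAt nothing nothing m ⇔-∘ ∈-chains nothing nothing m))
            , length-chains nothing nothing n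

r01 r10 r02 r20 r12 r21 : Row
r01 = row fz (fs fz)
r10 = row (fs fz) fz
r02 = row fz (fs (fs fz))
r20 = row (fs (fs fz)) fz
r12 = row (fs fz) (fs (fs fz))
r21 = row (fs (fs fz)) (fs fz)

-- Successors of a pair of consecutive rows, read off from #chains:
--   01 10 ↦ 01, 21    10 01 ↦ 10, 12    10 21 ↦ 01, 02    01 12 ↦ 01, 20
--   12 01 ↦ 10        12 20 ↦ 01        02 10 ↦ 01, 21    21 01 ↦ 10
--   21 02 ↦ 10        20 01 ↦ 10, 12
extensions : Row → Row → ℕ → ℕ
extensions x y = #chains (just x) (just y)

-- A row influences the row two below it only through the positions of its zeros,
-- and r02, r20, r12 have the same zeros as r01, r10, r21 respectively.
extensions-r02-r10 : ∀ k → extensions r02 r10 k ≡ extensions r01 r10 k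
extensions-r02-r10 zero    = refl
extensions-r02-r10 (suc k) = refl

extensions-r20-r01 : ∀ k → extensions r20 r01 k ≡ extensions r10 r01 k
extensions-r20-r01 zero    = refl
extensions-r20-r01 (suc k) = refl

extensions-r12-r01 : ∀ k → extensions r12 r01 k ≡ extensions r21 r01 k
extensions-r12-r01 zero    = refl
extensions-r12-r01 (suc k) = refl

extensions-r01-r10 : ∀ k → extensions r01 r10 k ≡ extensions r10 r01 k
extensions-r10-r21 : ∀ k → extensions r10 r21 k ≡ extensions r01 r12 k
extensions-r21-r02 : ∀ k → extensions r21 r02 k ≡ extensions r12 r20 k

extensions-r01-r10 zero    = refl
extensions-r01-r10 (suc k) =
  cong₂ _+_ (sym (extensions-r01-r10 k)) (cong (_+ 0) (extensions-r10-r21 k))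
extensions-r10-r21 zero    = refl
extensions-r10-r21 (suc k) =
  cong₂ _+_ (sym (extensions-r12-r01 k)) (cong (_+ 0) (extensions-r21-r02 k))
extensions-r21-r02 zero    = refl
extensions-r21-r02 (suc k) = cong (_+ 0) (begin
  extensions r02 r10 k ≡⟨ extensions-r02-r10 k ⟩
  extensions r01 r10 k ≡⟨ extensions-r01-r10 k ⟩
  extensions r10 r01 k ≡⟨ extensions-r20-r01 k ⟨
  extensions r20 r01 k ∎)

extensions-recurrence : ∀ k →
  extensions r01 r10 (3 + k) ≡ extensions r01 r10 (2 + k) + 2 * extensions r01 r10 k
extensions-recurrence k = begin
  e (3 + k)
    ≡⟨⟩
  extensions r10 r01 (2 + k) + (extensions r10 r21 (2 + k) + 0)
    ≡⟨ cong₂ _+_ (sym (extensions-r01-r10 (2 + k))) (+-identityʳ _) ⟩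
  e (2 + k) + extensions r10 r21 (2 + k)
    ≡⟨⟩
  e (2 + k) + ((e k + 0) + ((extensions r02 r10 k + 0) + 0))
    ≡⟨ cong (e (2 + k) +_) (cong₂ _+_ (+-identityʳ (e k)) twice-e) ⟩
  e (2 + k) + 2 * e k ∎
  where
  e : ℕ → ℕ
  e = extensions r01 r10
  twice-e : (extensions r02 r10 k + 0) + 0 ≡ e k + 0
  twice-e = trans (+-identityʳ _) (cong (_+ 0) (extensions-r02-r10 k))

#A≡extensions : ∀ k → #chains nothing nothing (2 + k) ≡ extensions r01 r10 k
#A≡extensions k = trans (+-identityʳ _) (+-identityʳ _)

d : ℕ → ℕ
d = #chains nothing nothing

d-recurrence : ∀ k → d (4 + k) ≡ d (3 + k) + 2 * d (1 + k)
d-recurrence zero    = refl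
d-recurrence (suc k) = begin
  d (5 + k)                      ≡⟨ #A≡extensions (3 + k) ⟩
  e (3 + k)                      ≡⟨ extensions-recurrence k ⟩
  e (2 + k) + 2 * e k            ≡⟨ cong₂ (λ x y → x + 2 * y) (#A≡extensions (2 + k)) (#A≡extensions k) ⟨
  d (4 + k) + 2 * d (2 + k)      ∎
  where
  e : ℕ → ℕ
  e = extensions r01 r10

theorem5 : Σ (ℕ → ℕ) λ d →
    ((n : ℕ) → 1 ≤ n → HasCard n (d n))
    × d 1 ≡ 1 × d 2 ≡ 1 × d 3 ≡ 2
    × ((n : ℕ) → 4 ≤ n → d n ≡ d (n ∸ 1) + 2 * d (n ∸ 3))
theorem5 = d , (λ n _ → A-hasCard n) , refl , refl , refl , recurrence
  where
  recurrence : (n : ℕ) → 4 ≤ n → d n ≡ d (n ∸ 1) + 2 * d (n ∸ 3)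
  recurrence _ (s≤s (s≤s (s≤s (s≤s {n = k} _)))) = d-recurrence k
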